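{- For every positive integer $\sigma$ there exists a string $s$ containing exactly $\sigma$ distinct characters such that $s$ has $\sigma$ prefixes $w$ each of which is a parameterized square and has no parameterized occurrence in $s$ other than the one at position $1$ (i.e., there is no $i \ge 2$ with $i+|w|-1\le|s|$ and $s[i..i+|w|-1] \approx w$).
   Context: Two strings $x,y$ of equal length $k$ over an alphabet $\Sigma$ are parameterized equivalent, written $x \approx y$, if there is a bijection $f:\Sigma\to\Sigma$ with $f(x[i]) = y[i]$ for all $1 \le i \le k$. A string $w$ is a parameterized square if $w = xy$ for strings $x,y$ with $x \approx y$. For a string $s$, $s[i..j]$ denotes the substring from position $i$ to position $j$ (positions start at 1). -}

module Defs where

open import Data.Nat using (ℕ; _+_; _≤_; _<_; suc)
open import Data.List using (List; map; length; take; drop; _++_)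
open import Data.List.Membership.Propositional using (_∈_)
open import Data.List.Relation.Unary.Unique.Propositional using (Unique)
open import Data.List.Relation.Unary.All using (All)
open import Data.Product using (Σ; ∃; _×_; ∃-syntax)
open import Function.Bundles using (_⤖_; Bijection; _⇔_)
open import Relation.Binary.PropositionalEquality using (_≡_)
open import Relation.Nullary using (¬_)

Str : Set
Str = List ℕ

-- parameterized equivalence: a bijection f : Σ → Σ mapping x letterwise onto y
-- (map f x ≡ y forces |x| = |y|)
_≈ₚ_ : Str → Str → Set
x ≈ₚ y = Σ (ℕ ⤖ ℕ) (λ f → map (Bijection.to f) x ≡ y)

PSquare : Str → Set
PSquare w = ∃[ x ] ∃[ y ] (w ≡ x ++ y × x ≈ₚ y)

HasExactlyDistinct : Str → ℕ → Set
HasExactlyDistinct s σ =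
  ∃[ cs ] (Unique cs × length cs ≡ σ × (∀ c → (c ∈ cs) ⇔ (c ∈ s)))

-- substring of length m starting at 0-based offset d, i.e. s[d+1 .. d+m]
sub : Str → ℕ → ℕ → Str
sub s d m = take m (drop d s)

-- the prefix w of s has no parameterized occurrence in s other than at position 1:
-- no i ≥ 2 (offset d = i - 1 ≥ 1) with i + |w| - 1 ≤ |s| and s[i..i+|w|-1] ≈ w
UniquePOccPrefix : Str → Str → Set
UniquePOccPrefix s w =
  ∀ d → 1 ≤ d → d + length w ≤ length s → ¬ (sub s d (length w) ≈ₚ w)

{-# OPTIONS --safe #-}
module Submission where

-- For n ≥ 1 let s = 0 1 ⋯ (n−1) 0 · (1 2 ⋯ n)³ · 0: the word i ↦ i mod n of length 4n+1 in
-- which every 0 after position n is renamed n, followed by one final 0. Its letters are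
-- 0, …, n. For n < m ≤ 2n+1 the prefix of length 2m is a parameterized square: its second
-- half is its first half shifted by m along the period, so "rotate the residues mod n by m,
-- then swap 0 and n" maps the one onto the other. Such a prefix carries the distinct letters
-- 0 and n at positions n and 2n (counting from 0), whereas in any later window these
-- positions both fall into the renamed periodic part, n apart, and so carry equal letters;
-- hence there is no later parameterized occurrence. For σ = 1 the word 00 does the job.

open import Defs
open import Data.Nat
  using ( ℕ; zero; suc; pred; _+_; _*_; _∸_; _%_; _≤_; _<_; _≤?_; _<?_; _≟_
        ; NonZero; >-nonZero⁻¹; ≢-nonZero⁻¹; z≤n; s≤s; s≤s⁻¹; z<s; s<s)
open import Data.Nat.Properties
open import Data.Nat.DivMod
  using ( %-distribˡ-+; m%n%n≡m%n; [m+n]%n≡m%n; [m+kn]%n≡m%n; m%n<n; m<n⇒m%n≡m; n%n≡0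
        ; m≤n⇒[n∸m]%m≡n%m)
open import Data.Nat.Tactic.RingSolver using (solve-∀)
open import Data.List using ([]; _∷_; _++_; take; length; applyUpTo; upTo)
open import Data.List.Properties using (length-applyUpTo; length-upTo; map-applyUpTo; ∷-injective)
open import Data.List.Membership.Propositional using (_∈_)
open import Data.List.Membership.Propositional.Properties
  using (∈-applyUpTo⁺; ∈-applyUpTo⁻; ∈-upTo⁺; ∈-upTo⁻)
open import Data.List.Relation.Unary.All using (All; []; _∷_)
import Data.List.Relation.Unary.All.Properties as All
open import Data.List.Relation.Unary.Unique.Propositional using (Unique; []; _∷_)
import Data.List.Relation.Unary.Unique.Propositional.Properties as Unique
open import Data.Product using (∃₂; _×_; ∃-syntax; _,_; proj₁; proj₂)
open import Data.Sum using (inj₁; inj₂)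
open import Function.Base using (_∘_)
open import Function.Bundles using (_⤖_; Bijection; mk⇔; mk↔ₛ′)
open import Function.Construct.Composition using (_⤖-∘_)
open import Function.Construct.Identity using (⤖-id)
open import Function.Properties.Inverse using (↔⇒⤖)
open import Relation.Binary.PropositionalEquality
  using (_≡_; _≢_; refl; sym; trans; cong; cong₂; subst; subst₂; module ≡-Reasoning)
open import Relation.Nullary using (¬_; Dec; yes; no; contradiction)

open Bijection using (to)

module _ {a} {A : Set a} where

  take-applyUpTo : ∀ (g : ℕ → A) {ℓ L} → ℓ ≤ L → take ℓ (applyUpTo g L) ≡ applyUpTo g ℓ
  take-applyUpTo g {zero}  _         = refl
  take-applyUpTo g {suc ℓ} (s≤s ℓ≤L) = cong (g 0 ∷_) (take-applyUpTo (g ∘ suc) ℓ≤L)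

  applyUpTo-++ : ∀ (g : ℕ → A) m {k} → applyUpTo g (m + k) ≡ applyUpTo g m ++ applyUpTo (g ∘ (m +_)) k
  applyUpTo-++ g zero    = refl
  applyUpTo-++ g (suc m) = cong (g 0 ∷_) (applyUpTo-++ (g ∘ suc) m)

  applyUpTo-cong : ∀ (g h : ℕ → A) ℓ → (∀ {i} → i < ℓ → g i ≡ h i) → applyUpTo g ℓ ≡ applyUpTo h ℓ
  applyUpTo-cong g h zero    _  = refl
  applyUpTo-cong g h (suc ℓ) eq =
    cong₂ _∷_ (eq z<s) (applyUpTo-cong (g ∘ suc) (h ∘ suc) ℓ (λ i<ℓ → eq (s<s i<ℓ)))

  applyUpTo-injective : ∀ (g h : ℕ → A) ℓ → applyUpTo g ℓ ≡ applyUpTo h ℓ → ∀ {i} → i < ℓ → g i ≡ h i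
  applyUpTo-injective g h (suc ℓ) eq {zero}  z<s       = proj₁ (∷-injective eq)
  applyUpTo-injective g h (suc ℓ) eq {suc i} (s<s i<ℓ) =
    applyUpTo-injective (g ∘ suc) (h ∘ suc) ℓ (proj₂ (∷-injective eq)) i<ℓ

sub-applyUpTo : ∀ (g : ℕ → ℕ) d {ℓ L} → d + ℓ ≤ L → sub (applyUpTo g L) d ℓ ≡ applyUpTo (g ∘ (d +_)) ℓ
sub-applyUpTo g zero    ℓ≤L                  = take-applyUpTo g ℓ≤L
sub-applyUpTo g (suc d) {L = suc L} (s≤s le) = sub-applyUpTo (g ∘ suc) d le

≈ₚ-applyUpTo⁺ : ∀ (f : ℕ ⤖ ℕ) (g h : ℕ → ℕ) ℓ → (∀ {i} → i < ℓ → to f (g i) ≡ h i) →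
                applyUpTo g ℓ ≈ₚ applyUpTo h ℓ
≈ₚ-applyUpTo⁺ f g h ℓ eq = f , trans (map-applyUpTo g (to f) ℓ) (applyUpTo-cong (to f ∘ g) h ℓ eq)

≈ₚ-applyUpTo-preserves-≡ : ∀ (g h : ℕ → ℕ) ℓ → applyUpTo g ℓ ≈ₚ applyUpTo h ℓ →
                           ∀ {p q} → p < ℓ → q < ℓ → g p ≡ g q → h p ≡ h q
≈ₚ-applyUpTo-preserves-≡ g h ℓ (f , e) {p} {q} p<ℓ q<ℓ gp≡gq = begin
  h p         ≡⟨ mapped p<ℓ ⟨
  to f (g p)  ≡⟨ cong (to f) gp≡gq ⟩
  to f (g q)  ≡⟨ mapped q<ℓ ⟩
  h q         ∎
  where
  open ≡-Reasoning
  mapped : ∀ {i} → i < ℓ → to f (g i) ≡ h i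
  mapped = applyUpTo-injective (to f ∘ g) h ℓ (trans (sym (map-applyUpTo g (to f) ℓ)) e)

pSquare-applyUpTo : ∀ (g : ℕ → ℕ) m (f : ℕ ⤖ ℕ) → (∀ {i} → i < m → to f (g i) ≡ g (m + i)) →
                    PSquare (applyUpTo g (m + m))
pSquare-applyUpTo g m f eq =
  applyUpTo g m , applyUpTo (g ∘ (m +_)) m , applyUpTo-++ g m , ≈ₚ-applyUpTo⁺ f g (g ∘ (m +_)) m eq

uniquePOccPrefix-applyUpTo :
  ∀ (g : ℕ → ℕ) ℓ L →
  (∀ {d} → 1 ≤ d → d + ℓ ≤ L → ∃₂ λ p q → p < ℓ × q < ℓ × g (d + p) ≡ g (d + q) × g p ≢ g q) →
  UniquePOccPrefix (applyUpTo g L) (applyUpTo g ℓ)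
uniquePOccPrefix-applyUpTo g ℓ L pattern-broken d 1≤d le occurrence =
  let p , q , p<ℓ , q<ℓ , shifted-≡ , gp≢gq = pattern-broken 1≤d d+ℓ≤L
  in  gp≢gq (≈ₚ-applyUpTo-preserves-≡ (g ∘ (d +_)) g ℓ window p<ℓ q<ℓ shifted-≡)
  where
  d+ℓ≤L : d + ℓ ≤ L
  d+ℓ≤L = subst₂ (λ a b → d + a ≤ b) (length-applyUpTo g ℓ) (length-applyUpTo g L) le
  window : applyUpTo (g ∘ (d +_)) ℓ ≈ₚ applyUpTo g ℓ
  window = subst (_≈ₚ applyUpTo g ℓ)
                 (trans (cong (sub (applyUpTo g L) d) (length-applyUpTo g ℓ)) (sub-applyUpTo g d d+ℓ≤L))
                 occurrence

UniqueSquarePrefix : Str → ℕ → Set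
UniqueSquarePrefix s ℓ = ℓ ≤ length s × PSquare (take ℓ s) × UniquePOccPrefix s (take ℓ s)

uniqueSquarePrefix-applyUpTo : ∀ (g : ℕ → ℕ) {ℓ L} → ℓ ≤ L → PSquare (applyUpTo g ℓ) →
                               UniquePOccPrefix (applyUpTo g L) (applyUpTo g ℓ) →
                               UniqueSquarePrefix (applyUpTo g L) ℓ
uniqueSquarePrefix-applyUpTo g {ℓ} {L} ℓ≤L square unique =
  subst (ℓ ≤_) (sym (length-applyUpTo g L)) ℓ≤L ,
  subst (λ w → PSquare w × UniquePOccPrefix (applyUpTo g L) w) (sym (take-applyUpTo g ℓ≤L))
        (square , unique)

hasExactlyDistinct-upTo : ∀ {s σ} → (∀ {c} → c ∈ s → c < σ) → (∀ {c} → c < σ → c ∈ s) →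
                          HasExactlyDistinct s σ
hasExactlyDistinct-upTo {σ = σ} bounded covered =
  upTo σ , Unique.upTo⁺ σ , length-upTo σ , λ _ → mk⇔ (covered ∘ ∈-upTo⁻) (∈-upTo⁺ ∘ bounded)

transpose : ℕ → ℕ → ℕ → ℕ
transpose a b x with x ≟ a
... | yes _ = b
... | no _ with x ≟ b
...   | yes _ = a
...   | no _  = x

module _ (a b : ℕ) where

  transpose-ˡ : transpose a b a ≡ b
  transpose-ˡ with a ≟ a
  ... | yes _   = refl
  ... | no a≢a = contradiction refl a≢a

  transpose-ʳ : transpose a b b ≡ a
  transpose-ʳ with b ≟ a
  ... | yes b≡a = b≡a
  ... | no _ with b ≟ b
  ...   | yes _   = refl
  ...   | no b≢b = contradiction refl b≢b

  transpose-fix : ∀ {x} → x ≢ a → x ≢ b → transpose a b x ≡ x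
  transpose-fix {x} x≢a x≢b with x ≟ a
  ... | yes x≡a = contradiction x≡a x≢a
  ... | no _ with x ≟ b
  ...   | yes x≡b = contradiction x≡b x≢b
  ...   | no _    = refl

  transpose-involutive : ∀ x → transpose a b (transpose a b x) ≡ x
  transpose-involutive x = by-cases (x ≟ a) (x ≟ b)
    where
    involutive-at : ℕ → Set
    involutive-at y = transpose a b (transpose a b y) ≡ y
    by-cases : Dec (x ≡ a) → Dec (x ≡ b) → involutive-at x
    by-cases (yes x≡a) _         =
      subst involutive-at (sym x≡a) (trans (cong (transpose a b) transpose-ˡ) transpose-ʳ)
    by-cases (no _)    (yes x≡b) =
      subst involutive-at (sym x≡b) (trans (cong (transpose a b) transpose-ʳ) transpose-ˡ)
    by-cases (no x≢a)  (no x≢b)  =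
      trans (cong (transpose a b) (transpose-fix x≢a x≢b)) (transpose-fix x≢a x≢b)

  transposition : ℕ ⤖ ℕ
  transposition = ↔⇒⤖ (mk↔ₛ′ (transpose a b) (transpose a b) transpose-involutive transpose-involutive)

[m%d+n]%d≡[m+n]%d : ∀ m n d .{{_ : NonZero d}} → (m % d + n) % d ≡ (m + n) % d
[m%d+n]%d≡[m+n]%d m n d = begin
  (m % d + n) % d           ≡⟨ %-distribˡ-+ (m % d) n d ⟩
  (m % d % d + n % d) % d   ≡⟨ cong (λ r → (r + n % d) % d) (m%n%n≡m%n m d) ⟩
  (m % d + n % d) % d       ≡⟨ %-distribˡ-+ m n d ⟨
  (m + n) % d               ∎
  where open ≡-Reasoning

module Rotation (n : ℕ) .{{_ : NonZero n}} where

  rotate : ℕ → ℕ → ℕ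
  rotate c a with a <? n
  ... | yes _ = (a + c) % n
  ... | no _  = a

  rotate-< : ∀ {c a} → a < n → rotate c a ≡ (a + c) % n
  rotate-< {c} {a} a<n with a <? n
  ... | yes _   = refl
  ... | no a≮n = contradiction a<n a≮n

  rotate-≥ : ∀ {c a} → n ≤ a → rotate c a ≡ a
  rotate-≥ {c} {a} n≤a with a <? n
  ... | yes a<n = contradiction n≤a (<⇒≱ a<n)
  ... | no _    = refl

  rotate-∘ : ∀ c c′ a → rotate c′ (rotate c a) ≡ rotate (c + c′) a
  rotate-∘ c c′ a with a <? n
  ... | no a≮n  = rotate-≥ (≮⇒≥ a≮n)
  ... | yes a<n = begin
    rotate c′ ((a + c) % n)   ≡⟨ rotate-< (m%n<n (a + c) n) ⟩
    ((a + c) % n + c′) % n   ≡⟨ [m%d+n]%d≡[m+n]%d (a + c) c′ n ⟩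
    (a + c + c′) % n         ≡⟨ cong (_% n) (+-assoc a c c′) ⟩
    (a + (c + c′)) % n       ∎
    where open ≡-Reasoning

  rotate-multiple : ∀ k a → rotate (k * n) a ≡ a
  rotate-multiple k a with a <? n
  ... | yes a<n = trans ([m+kn]%n≡m%n a k n) (m<n⇒m%n≡m a<n)
  ... | no _    = refl

  -- rotate c is inverted by rotate (c * (n − 1)), as c + c * (n − 1) is a multiple of n.
  rotation : ℕ → ℕ ⤖ ℕ
  rotation c = ↔⇒⤖ (mk↔ₛ′ (rotate c) (rotate c⁻¹)
                           (cancel c⁻¹ c (trans (+-comm c⁻¹ c) c+c⁻¹≡cn)) (cancel c c⁻¹ c+c⁻¹≡cn))
    where
    c⁻¹ : ℕ
    c⁻¹ = c * pred n
    c+c⁻¹≡cn : c + c⁻¹ ≡ c * n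
    c+c⁻¹≡cn = trans (sym (*-suc c (pred n))) (cong (c *_) (suc-pred n))
    cancel : ∀ e e′ → e + e′ ≡ c * n → ∀ a → rotate e′ (rotate e a) ≡ a
    cancel e e′ e+e′≡cn a =
      trans (rotate-∘ e e′ a) (trans (cong (λ k → rotate k a) e+e′≡cn) (rotate-multiple c a))

module Construction (n : ℕ) .{{_ : NonZero n}} where
  open Rotation n

  halfLength : ℕ → ℕ
  halfLength j = suc (n + j)

  prefixLength : ℕ → ℕ
  prefixLength j = halfLength j + halfLength j

  len : ℕ
  len = prefixLength n

  rename : ℕ → ℕ
  rename = transpose 0 n

  letter : ℕ → ℕ
  letter i with i ≤? n | suc i <? len
  ... | yes _ | _     = i % n
  ... | no _  | yes _ = rename (i % n)
  ... | no _  | no _  = 0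

  s : Str
  s = applyUpTo letter len

  letter-initial : ∀ {i} → i ≤ n → letter i ≡ i % n
  letter-initial {i} i≤n with i ≤? n
  ... | yes _   = refl
  ... | no i≰n = contradiction i≤n i≰n

  letter-renamed : ∀ {i} → n < i → suc i < len → letter i ≡ rename (i % n)
  letter-renamed {i} n<i i<len with i ≤? n | suc i <? len
  ... | yes i≤n | _        = contradiction i≤n (<⇒≱ n<i)
  ... | no _    | yes _    = refl
  ... | no _    | no i≮len = contradiction i<len i≮len

  letter-last : ∀ {i} → n < i → ¬ suc i < len → letter i ≡ 0
  letter-last {i} n<i i≮len with i ≤? n | suc i <? len
  ... | yes i≤n | _       = contradiction i≤n (<⇒≱ n<i)
  ... | no _    | yes i<len = contradiction i<len i≮len
  ... | no _    | no _    = refl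

  n<n+n : n < n + n
  n<n+n = m<m+n n (>-nonZero⁻¹ n)

  <n+n⇒suc<len : ∀ {i} → i < n + n → suc i < len
  <n+n⇒suc<len i<n+n = ≤-trans (s≤s i<n+n) (m≤m+n (halfLength n) (halfLength n))

  rename-≤ : ∀ {r} → r < n → rename r ≤ n
  rename-≤ {r} r<n with 0 ≟ r
  ... | yes refl = ≤-reflexive (transpose-ˡ 0 n)
  ... | no 0≢r   = ≤-trans (≤-reflexive (transpose-fix 0 n (0≢r ∘ sym) (<⇒≢ r<n))) (<⇒≤ r<n)

  letter-bounded : ∀ i → letter i ≤ n
  letter-bounded i with i ≤? n | suc i <? len
  ... | yes _ | _     = <⇒≤ (m%n<n i n)
  ... | no _  | yes _ = rename-≤ (m%n<n i n)
  ... | no _  | no _  = z≤n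

  letter-n : letter n ≡ 0
  letter-n = trans (letter-initial ≤-refl) (n%n≡0 n)

  letter-n+n : letter (n + n) ≡ n
  letter-n+n = begin
    letter (n + n)           ≡⟨ letter-renamed n<n+n (m<m+n (halfLength n) z<s) ⟩
    rename ((n + n) % n)     ≡⟨ cong rename (trans ([m+n]%n≡m%n n n) (n%n≡0 n)) ⟩
    rename 0                 ≡⟨ transpose-ˡ 0 n ⟩
    n                        ∎
    where open ≡-Reasoning

  -- Below position 2n no letter was renamed, since only multiples of n are.
  letter-<n+n : ∀ {i} → i < n + n → letter i ≡ i % n
  letter-<n+n {i} i<n+n with n <? i
  ... | no n≮i  = letter-initial (≮⇒≥ n≮i)
  ... | yes n<i =
    trans (letter-renamed n<i (<n+n⇒suc<len i<n+n)) (transpose-fix 0 n i%n≢0 (<⇒≢ (m%n<n i n)))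
    where
    i%n≡i∸n : i % n ≡ i ∸ n
    i%n≡i∸n = trans (sym (m≤n⇒[n∸m]%m≡n%m (<⇒≤ n<i)))
                    (m<n⇒m%n≡m (subst (i ∸ n <_) (m+n∸m≡n n n) (∸-monoˡ-< i<n+n (<⇒≤ n<i))))
    i%n≢0 : i % n ≢ 0
    i%n≢0 = m>n⇒m∸n≢0 n<i ∘ trans (sym i%n≡i∸n)

  letter-periodic : ∀ {i} → n < i → suc (i + n) < len → letter i ≡ letter (i + n)
  letter-periodic {i} n<i i+n<len = begin
    letter i               ≡⟨ letter-renamed n<i (≤-<-trans (s≤s (m≤m+n i n)) i+n<len) ⟩
    rename (i % n)         ≡⟨ cong rename ([m+n]%n≡m%n i n) ⟨
    rename ((i + n) % n)   ≡⟨ letter-renamed (<-≤-trans n<i (m≤m+n i n)) i+n<len ⟨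
    letter (i + n)         ∎
    where open ≡-Reasoning

  squareBijection : ℕ → ℕ ⤖ ℕ
  squareBijection j = transposition 0 n ⤖-∘ rotation (halfLength j)

  squareBijection-letter-<n+n : ∀ {j i} → j ≤ n → i < n + n →
                                to (squareBijection j) (letter i) ≡ letter (halfLength j + i)
  squareBijection-letter-<n+n {j} {i} j≤n i<n+n = begin
    rename (rotate m (letter i))   ≡⟨ cong (rename ∘ rotate m) (letter-<n+n i<n+n) ⟩
    rename (rotate m (i % n))      ≡⟨ cong rename (rotate-< (m%n<n i n)) ⟩
    rename ((i % n + m) % n)      ≡⟨ cong rename ([m%d+n]%d≡[m+n]%d i m n) ⟩
    rename ((i + m) % n)          ≡⟨ cong (rename ∘ (_% n)) (+-comm i m) ⟩
    rename ((m + i) % n)          ≡⟨ letter-renamed n<m+i m+i<len ⟨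
    letter (m + i)                ∎
    where
    open ≡-Reasoning
    m : ℕ
    m = halfLength j
    n<m+i : n < m + i
    n<m+i = ≤-trans (s≤s (m≤m+n n j)) (m≤m+n m i)
    m+i<len : suc (m + i) < len
    m+i<len = subst (_≤ len) (trans (+-suc m (suc i)) (cong suc (+-suc m i)))
                    (+-mono-≤ (s≤s (+-monoʳ-≤ n j≤n)) (s≤s i<n+n))

  squareBijection-letter-last : to (squareBijection n) (letter (n + n)) ≡ letter (halfLength n + (n + n))
  squareBijection-letter-last = begin
    rename (rotate m (letter (n + n)))   ≡⟨ cong (rename ∘ rotate m) letter-n+n ⟩
    rename (rotate m n)                  ≡⟨ cong rename (rotate-≥ ≤-refl) ⟩
    rename n                             ≡⟨ transpose-ʳ 0 n ⟩
    0                                    ≡⟨ letter-last (≤-trans (s≤s (m≤m+n n n)) (m≤m+n m (n + n))) is-last ⟨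
    letter (m + (n + n))                 ∎
    where
    open ≡-Reasoning
    m : ℕ
    m = halfLength n
    is-last : ¬ suc (m + (n + n)) < len
    is-last = n≮n len ∘ subst (_< len) (sym (+-suc m (n + n)))

  squareBijection-letter : ∀ {j i} → j ≤ n → i < halfLength j →
                           to (squareBijection j) (letter i) ≡ letter (halfLength j + i)
  squareBijection-letter {j} {i} j≤n i<m with i <? n + n
  ... | yes i<n+n = squareBijection-letter-<n+n j≤n i<n+n
  ... | no i≮n+n  = subst₂ (λ j i → to (squareBijection j) (letter i) ≡ letter (halfLength j + i))
                           (sym j≡n) (sym i≡n+n) squareBijection-letter-last
    where
    n+n≤i : n + n ≤ i
    n+n≤i = ≮⇒≥ i≮n+n
    i≤n+j : i ≤ n + j
    i≤n+j = s≤s⁻¹ i<m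
    i≡n+n : i ≡ n + n
    i≡n+n = ≤-antisym (≤-trans i≤n+j (+-monoʳ-≤ n j≤n)) n+n≤i
    j≡n : j ≡ n
    j≡n = ≤-antisym j≤n (+-cancelˡ-≤ n n j (≤-trans n+n≤i i≤n+j))

  prefixLength-≤ : ∀ {j} → j ≤ n → prefixLength j ≤ len
  prefixLength-≤ j≤n = +-mono-≤ (s≤s (+-monoʳ-≤ n j≤n)) (s≤s (+-monoʳ-≤ n j≤n))

  prefixLength-< : ∀ {i j} → i < j → prefixLength i < prefixLength j
  prefixLength-< i<j = +-mono-< (s<s (+-monoʳ-< n i<j)) (s<s (+-monoʳ-< n i<j))

  prefixLength-≥ : ∀ j → suc n + suc n ≤ prefixLength j
  prefixLength-≥ j = +-mono-≤ (s≤s (m≤m+n n j)) (s≤s (m≤m+n n j))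

  n+n<prefixLength : ∀ j → n + n < prefixLength j
  n+n<prefixLength j = ≤-trans (s≤s (+-monoʳ-≤ n (n≤1+n n))) (prefixLength-≥ j)

  prefix-pSquare : ∀ {j} → j ≤ n → PSquare (applyUpTo letter (prefixLength j))
  prefix-pSquare {j} j≤n =
    pSquare-applyUpTo letter (halfLength j) (squareBijection j) (squareBijection-letter j≤n)

  prefix-uniquePOcc : ∀ j → UniquePOccPrefix s (applyUpTo letter (prefixLength j))
  prefix-uniquePOcc j = uniquePOccPrefix-applyUpTo letter (prefixLength j) len pattern-broken
    where
    pattern-broken : ∀ {d} → 1 ≤ d → d + prefixLength j ≤ len →
                     ∃₂ λ p q → p < prefixLength j × q < prefixLength j ×
                                letter (d + p) ≡ letter (d + q) × letter p ≢ letter q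
    pattern-broken {d} 1≤d fits =
      n , n + n , <-trans n<n+n (n+n<prefixLength j) , n+n<prefixLength j , shifted , 0≢n ∘ unshifted
      where
      shape : ∀ a b → suc (suc (a + b + b)) ≡ a + (suc b + suc b)
      shape = solve-∀
      d+n+n<len : suc (d + n + n) < len
      d+n+n<len = ≤-trans (≤-reflexive (shape d n)) (≤-trans (+-monoʳ-≤ d (prefixLength-≥ j)) fits)
      shifted : letter (d + n) ≡ letter (d + (n + n))
      shifted = trans (letter-periodic (m<n+m n 1≤d) d+n+n<len) (cong letter (+-assoc d n n))
      unshifted : letter n ≡ letter (n + n) → 0 ≡ n
      unshifted eq = trans (sym letter-n) (trans eq letter-n+n)
      0≢n : 0 ≢ n
      0≢n = ≢-nonZero⁻¹ n ∘ sym

  uniqueSquarePrefix : ∀ {j} → j ≤ n → UniqueSquarePrefix s (prefixLength j)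
  uniqueSquarePrefix {j} j≤n =
    uniqueSquarePrefix-applyUpTo letter (prefixLength-≤ j≤n) (prefix-pSquare j≤n) (prefix-uniquePOcc j)

  letters-exactly : HasExactlyDistinct s (suc n)
  letters-exactly = hasExactlyDistinct-upTo bounded covered
    where
    bounded : ∀ {c} → c ∈ s → c < suc n
    bounded c∈s = let i , _ , c≡letter-i = ∈-applyUpTo⁻ letter c∈s in
                  subst (_< suc n) (sym c≡letter-i) (s≤s (letter-bounded i))
    covered : ∀ {c} → c < suc n → c ∈ s
    covered {c} c<1+n with m≤n⇒m<n∨m≡n (s≤s⁻¹ c<1+n)
    ... | inj₁ c<n  = subst (_∈ s) (trans (letter-initial (<⇒≤ c<n)) (m<n⇒m%n≡m c<n))
                            (∈-applyUpTo⁺ letter (<-trans c<n (<-trans n<n+n (m≤m+n (halfLength n) _))))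
    ... | inj₂ refl = subst (_∈ s) letter-n+n (∈-applyUpTo⁺ letter (m≤m+n (halfLength n) _))

module SingleLetter where

  s : Str
  s = applyUpTo (λ _ → 0) 2

  letters-exactly : HasExactlyDistinct s 1
  letters-exactly = hasExactlyDistinct-upTo bounded covered
    where
    bounded : ∀ {c} → c ∈ s → c < 1
    bounded c∈s = let _ , _ , c≡0 = ∈-applyUpTo⁻ (λ _ → 0) c∈s in subst (_< 1) (sym c≡0) z<s
    covered : ∀ {c} → c < 1 → c ∈ s
    covered z<s = ∈-applyUpTo⁺ (λ _ → 0) z<s

  uniqueSquarePrefix : UniqueSquarePrefix s 2
  uniqueSquarePrefix =
    uniqueSquarePrefix-applyUpTo (λ _ → 0) ≤-refl
      (pSquare-applyUpTo (λ _ → 0) 1 (⤖-id ℕ) (λ _ → refl))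
      (uniquePOccPrefix-applyUpTo (λ _ → 0) 2 2 no-later-window)
    where
    no-later-window : ∀ {d} {A : Set} → 1 ≤ d → d + 2 ≤ 2 → A
    no-later-window 1≤d d+2≤2 = contradiction (≤-trans (+-monoˡ-≤ 2 1≤d) d+2≤2) (n≮n 2)

lemma15 : (σ : ℕ) → 1 ≤ σ →
    ∃[ s ] (HasExactlyDistinct s σ ×
      ∃[ ls ] (Unique ls × length ls ≡ σ ×
        All (λ ℓ → ℓ ≤ length s × PSquare (take ℓ s) × UniquePOccPrefix s (take ℓ s)) ls))
lemma15 (suc zero) _ = s , letters-exactly , 2 ∷ [] , [] ∷ [] , refl , uniqueSquarePrefix ∷ []
  where open SingleLetter
lemma15 (suc n@(suc _)) _ =
  s , letters-exactly ,
  applyUpTo prefixLength (suc n) ,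
  Unique.applyUpTo⁺₁ prefixLength (suc n) (λ i<j _ → <⇒≢ (prefixLength-< i<j)) ,
  length-applyUpTo prefixLength (suc n) ,
  All.applyUpTo⁺₁ prefixLength (suc n) (uniqueSquarePrefix ∘ s≤s⁻¹)
  where open Construction n
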